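{- Let $P=\begin{bmatrix}a&b\\ c&d\end{bmatrix}$ with $a,b,c,d\in\mathbb{Z}$, $1\le|a|<|c|<|d|$, $|a|<|b|<|d|$ and $|ad-bc|=1$. (1) Suppose there do not exist positive integers $r_1,r_2,r_3,r_4$ with $r_3<r_4$ such that $\frac{r_1}{r_2}\le\frac{|a|}{|c|},\frac{|b|}{|d|}\le\frac{r_3}{r_4}$ and $|d|>r_2$, $|d|>r_4$. Then $|b|=|c|=|d|-1=|a|+1$. (2) Suppose there do not exist positive integers $r_1,r_2,r_3,r_4$ with $r_3<r_4$ such that $\frac{r_1}{r_2}\le\frac{|a|}{|b|},\frac{|c|}{|d|}\le\frac{r_3}{r_4}$ and $|d|>r_2$, $|d|>r_4$. Then $|b|=|c|=|d|-1=|a|+1$.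
   Context: An inequality of the form $x\le u,v\le y$ means that both $u$ and $v$ lie in the interval $[x,y]$. -}

module Defs where

open import Data.Nat using (ℕ; _*_; _≤_; _<_)
open import Data.Product using (_×_; ∃-syntax)

_/_≤ᶠ_/_ : ℕ → ℕ → ℕ → ℕ → Set
p / q ≤ᶠ r / s = p * s ≤ r * q

Sandwich : (x₁ y₁ x₂ y₂ D : ℕ) → Set
Sandwich x₁ y₁ x₂ y₂ D =
  ∃[ r₁ ] ∃[ r₂ ] ∃[ r₃ ] ∃[ r₄ ]
    (0 < r₁ × 0 < r₂ × 0 < r₃ × 0 < r₄ × r₃ < r₄ ×
     (r₁ / r₂ ≤ᶠ x₁ / y₁) × (x₁ / y₁ ≤ᶠ r₃ / r₄) ×
     (r₁ / r₂ ≤ᶠ x₂ / y₂) × (x₂ / y₂ ≤ᶠ r₃ / r₄) ×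
     r₂ < D × r₄ < D)

{-# OPTIONS --safe #-}
-- Write |d| = e + 2. If |b| ≤ e, then 1/(e+1) ≤ |a|/|c|, |b|/|d| ≤ e/(e+1) is a sandwich,
-- so |b| = e + 1; the second case is the first with b and c exchanged. As |a||d| and |b||c|
-- differ by one, |c| ≤ e would leave a gap of at least two between them, so |c| = e + 1,
-- and then (e+1)² = e(e+2) + 1 forces |a| = e.
module Submission where

open import Defs
open import Data.Nat as ℕ using (ℕ; zero; suc; _≤_; _<_; _∸_; s≤s; z≤n)
open import Data.Product using (_×_; _,_)
open import Data.Sum using (_⊎_; inj₁; inj₂)
open import Data.Empty using (⊥-elim)
open import Relation.Nullary using (¬_)
open import Relation.Binary.PropositionalEquality

Adjacent : ℕ → ℕ → Set
Adjacent m n = m ≡ suc n ⊎ n ≡ suc m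

-- Kept in a block of its own so that _+_ and _*_ outside it are those of ℤ, as in the statement.
module _ where
  open import Data.Nat using (_+_; _*_)
  open import Data.Nat.Properties
  open import Data.Nat.Tactic.RingSolver using (solve-∀; solve)
  open import Data.List using (_∷_; [])

  m+2≤n⇒¬adjacent : ∀ {m n} → m + 2 ≤ n → ¬ Adjacent m n
  m+2≤n⇒¬adjacent {m} m+2≤n (inj₁ refl) = <-irrefl refl (≤-trans (m≤m+n _ 2) m+2≤n)
  m+2≤n⇒¬adjacent {m} m+2≤n (inj₂ refl) =
    <-irrefl refl (≤-trans (≤-reflexive (+-comm 2 m)) m+2≤n)

  extreme-sandwich : ∀ {x₁ y₁ x₂ y₂ e} → 0 < e →
    (1 / suc e ≤ᶠ x₁ / y₁) × (x₁ / y₁ ≤ᶠ e / suc e) →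
    (1 / suc e ≤ᶠ x₂ / y₂) × (x₂ / y₂ ≤ᶠ e / suc e) →
    Sandwich x₁ y₁ x₂ y₂ (suc (suc e))
  extreme-sandwich 0<e (l₁ , u₁) (l₂ , u₂) =
    1 , _ , _ , _ , s≤s z≤n , s≤s z≤n , 0<e , s≤s z≤n , ≤-refl ,
    l₁ , u₁ , l₂ , u₂ , ≤-refl , ≤-refl

  m*[1+n]≤n*[1+m] : ∀ {m n} → m ≤ n → m * suc n ≤ n * suc m
  m*[1+n]≤n*[1+m] {m} {n} m≤n = begin
    m * suc n  ≡⟨ *-suc m n ⟩
    m + m * n  ≤⟨ +-monoˡ-≤ (m * n) m≤n ⟩
    n + m * n  ≡⟨ cong (λ k → n + k) (*-comm m n) ⟩
    n + n * m  ≡⟨ sym (*-suc n m) ⟩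
    n * suc m  ∎
    where open ≤-Reasoning

  proper-fraction-bounds : ∀ {x y n} → 0 < x → x < y → y ≤ suc n →
    (1 / suc n ≤ᶠ x / y) × (x / y ≤ᶠ n / suc n)
  proper-fraction-bounds {x} {y} {n} 0<x x<y y≤1+n = lower , upper
    where
    open ≤-Reasoning
    lower : 1 * y ≤ x * suc n
    lower = begin
      1 * y      ≡⟨ *-identityˡ y ⟩
      y          ≤⟨ y≤1+n ⟩
      suc n      ≡⟨ sym (*-identityˡ (suc n)) ⟩
      1 * suc n  ≤⟨ *-monoˡ-≤ (suc n) 0<x ⟩
      x * suc n  ∎
    upper : x * suc n ≤ n * y
    upper = begin
      x * suc n  ≤⟨ m*[1+n]≤n*[1+m] (≤-pred (≤-trans x<y y≤1+n)) ⟩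
      n * suc x  ≤⟨ *-monoʳ-≤ n x<y ⟩
      n * y      ∎

  fraction-over-2+n-bounds : ∀ {x n} → 2 ≤ x → x ≤ n →
    (1 / suc n ≤ᶠ x / suc (suc n)) × (x / suc (suc n) ≤ᶠ n / suc n)
  fraction-over-2+n-bounds {x} {n} 2≤x x≤n = lower , upper
    where
    open ≤-Reasoning
    lower : 1 * suc (suc n) ≤ x * suc n
    lower = begin
      1 * suc (suc n)  ≡⟨ *-identityˡ (suc (suc n)) ⟩
      suc (suc n)      ≤⟨ s≤s (m≤n+m (suc n) n) ⟩
      suc n + suc n    ≡⟨ solve (n ∷ []) ⟩
      2 * suc n        ≤⟨ *-monoˡ-≤ (suc n) 2≤x ⟩
      x * suc n        ∎
    upper : x * suc n ≤ n * suc (suc n)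
    upper = *-mono-≤ x≤n (n≤1+n (suc n))

  gap-below-diagonal : ∀ {a c e} → a < c → c ≤ e → a * suc (suc e) + 2 ≤ suc e * c
  gap-below-diagonal {a} {c} {e} a<c c≤e = +-cancelʳ-≤ e _ _ (begin
    a * suc (suc e) + 2 + e  ≡⟨ solve (a ∷ e ∷ []) ⟩
    suc a * suc (suc e)      ≤⟨ *-monoˡ-≤ (suc (suc e)) a<c ⟩
    c * suc (suc e)          ≡⟨ solve (c ∷ e ∷ []) ⟩
    suc e * c + c            ≤⟨ +-monoʳ-≤ (suc e * c) c≤e ⟩
    suc e * c + e            ∎)
    where open ≤-Reasoning

  [1+n]²≡1+n*[2+n] : ∀ n → suc n * suc n ≡ suc (n * suc (suc n))
  [1+n]²≡1+n*[2+n] = solve-∀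

  adjacent-to-square⇒≡ : ∀ {a e} → a ≤ e → Adjacent (a * suc (suc e)) (suc e * suc e) → a ≡ e
  adjacent-to-square⇒≡ {a} {e} a≤e (inj₁ aD≡1+[1+e]²) = ⊥-elim (<-irrefl refl (begin-strict
    e * suc (suc e)        <⟨ n<1+n _ ⟩
    suc (e * suc (suc e))  ≡⟨ sym ([1+n]²≡1+n*[2+n] e) ⟩
    suc e * suc e          <⟨ n<1+n _ ⟩
    suc (suc e * suc e)    ≡⟨ sym aD≡1+[1+e]² ⟩
    a * suc (suc e)        ≤⟨ *-monoˡ-≤ (suc (suc e)) a≤e ⟩
    e * suc (suc e)        ∎))
    where open ≤-Reasoning
  adjacent-to-square⇒≡ {a} {e} _ (inj₂ [1+e]²≡1+aD) =
    *-cancelʳ-≡ a e (suc (suc e)) (suc-injective (trans (sym [1+e]²≡1+aD) ([1+n]²≡1+n*[2+n] e)))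

  sandwich-free⇒b≡d∸1 : ∀ {a b c e} → 1 ≤ a → a < c → c ≤ suc e → a < b → b ≤ suc e →
    ¬ Sandwich a c b (suc (suc e)) (suc (suc e)) → b ≡ suc e
  sandwich-free⇒b≡d∸1 {a} {b} {c} {e} 1≤a a<c c≤1+e a<b b≤1+e free with m≤n⇒m<n∨m≡n b≤1+e
  ... | inj₂ b≡1+e = b≡1+e
  ... | inj₁ b<1+e = ⊥-elim (free (extreme-sandwich {a} {c} {b} 0<e
    (proper-fraction-bounds 1≤a a<c c≤1+e) (fraction-over-2+n-bounds 2≤b b≤e)))
    where
    2≤b : 2 ≤ b
    2≤b = ≤-trans (s≤s 1≤a) a<b
    b≤e : b ≤ e
    b≤e = ≤-pred b<1+e
    0<e : 0 < e
    0<e = ≤-trans (s≤s z≤n) (≤-trans 2≤b b≤e)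

  adjacent⇒c≡d∸1 : ∀ {a c e} → a < c → c ≤ suc e →
    Adjacent (a * suc (suc e)) (suc e * c) → c ≡ suc e
  adjacent⇒c≡d∸1 a<c c≤1+e adj with m≤n⇒m<n∨m≡n c≤1+e
  ... | inj₁ c<1+e = ⊥-elim (m+2≤n⇒¬adjacent (gap-below-diagonal a<c (≤-pred c<1+e)) adj)
  ... | inj₂ c≡1+e = c≡1+e

  sandwich-free-adjacent : ∀ {a b c d} → 1 ≤ a → a < c → c < d → a < b → b < d →
    Adjacent (a * d) (b * c) → ¬ Sandwich a c b d d →
    b ≡ c × c ≡ d ∸ 1 × d ∸ 1 ≡ suc a
  sandwich-free-adjacent {d = zero} _ _ () _ _ _ _
  sandwich-free-adjacent {d = suc zero} _ a<c (s≤s z≤n) _ _ _ _ = ⊥-elim (n≮0 a<c)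
  sandwich-free-adjacent {a} {b} {c} {suc (suc e)} 1≤a a<c c<d a<b b<d adj free =
    trans b≡1+e (sym c≡1+e) , c≡1+e , cong suc (sym a≡e)
    where
    c≤1+e : c ≤ suc e
    c≤1+e = ≤-pred c<d
    b≡1+e : b ≡ suc e
    b≡1+e = sandwich-free⇒b≡d∸1 1≤a a<c c≤1+e a<b (≤-pred b<d) free
    c≡1+e : c ≡ suc e
    c≡1+e = adjacent⇒c≡d∸1 a<c c≤1+e (subst (λ x → Adjacent _ (x * c)) b≡1+e adj)
    a≡e : a ≡ e
    a≡e = adjacent-to-square⇒≡ (≤-pred (≤-trans a<c c≤1+e))
      (subst₂ (λ x y → Adjacent _ (x * y)) b≡1+e c≡1+e adj)

open import Data.Integer using (ℤ; ∣_∣; _*_; _-_; +_; -[1+_]; _+_)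
import Data.Integer.Properties as ℤ
open import Data.Nat.Properties using (+-comm; +-identityʳ; *-comm)
open import Data.Integer.Tactic.RingSolver using () renaming (solve-∀ to ℤ-solve-∀)
open import Function using (_∘_)

∣i+±1∣-adjacent : ∀ i k → ∣ k ∣ ≡ 1 → Adjacent ∣ i + k ∣ ∣ i ∣
∣i+±1∣-adjacent (+ n)          (+ 1)    refl = inj₁ (+-comm n 1)
∣i+±1∣-adjacent (+ zero)       -[1+ 0 ] refl = inj₁ refl
∣i+±1∣-adjacent (+ suc n)      -[1+ 0 ] refl = inj₂ refl
∣i+±1∣-adjacent -[1+ zero ]    (+ 1)    refl = inj₂ refl
∣i+±1∣-adjacent -[1+ suc n ]   (+ 1)    refl = inj₂ refl
∣i+±1∣-adjacent -[1+ n ]       -[1+ 0 ] refl = inj₁ (cong (suc ∘ suc) (+-identityʳ n))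

∣i-j∣≡1⇒adjacent : ∀ i j → ∣ i - j ∣ ≡ 1 → Adjacent ∣ i ∣ ∣ j ∣
∣i-j∣≡1⇒adjacent i j ∣i-j∣≡1 =
  subst (λ x → Adjacent ∣ x ∣ ∣ j ∣) (j+[i-j]≡i i j) (∣i+±1∣-adjacent j (i - j) ∣i-j∣≡1)
  where
  j+[i-j]≡i : ∀ i j → j + (i - j) ≡ i
  j+[i-j]≡i = ℤ-solve-∀

unimodular⇒adjacent : ∀ a b c d → ∣ a * d - b * c ∣ ≡ 1 →
  Adjacent (∣ a ∣ ℕ.* ∣ d ∣) (∣ b ∣ ℕ.* ∣ c ∣)
unimodular⇒adjacent a b c d det =
  subst₂ Adjacent (ℤ.abs-* a d) (ℤ.abs-* b c) (∣i-j∣≡1⇒adjacent (a * d) (b * c) det)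

lemma2p2 : (a b c d : ℤ) →
    1 ≤ ∣ a ∣ → ∣ a ∣ < ∣ c ∣ → ∣ c ∣ < ∣ d ∣ →
    ∣ a ∣ < ∣ b ∣ → ∣ b ∣ < ∣ d ∣ →
    ∣ a * d - b * c ∣ ≡ 1 →
    (¬ Sandwich (∣ a ∣) (∣ c ∣) (∣ b ∣) (∣ d ∣) (∣ d ∣) →
      (∣ b ∣ ≡ ∣ c ∣ × ∣ c ∣ ≡ ∣ d ∣ ∸ 1 × ∣ d ∣ ∸ 1 ≡ suc ∣ a ∣))
    ×
    (¬ Sandwich (∣ a ∣) (∣ b ∣) (∣ c ∣) (∣ d ∣) (∣ d ∣) →
      (∣ b ∣ ≡ ∣ c ∣ × ∣ c ∣ ≡ ∣ d ∣ ∸ 1 × ∣ d ∣ ∸ 1 ≡ suc ∣ a ∣))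
lemma2p2 a b c d 1≤a a<c c<d a<b b<d det =
  sandwich-free-adjacent 1≤a a<c c<d a<b b<d adj ,
  λ free → let (c≡b , b≡d∸1 , d∸1≡1+a) = sandwich-free-adjacent 1≤a a<b b<d a<c c<d adj′ free
           in sym c≡b , trans c≡b b≡d∸1 , d∸1≡1+a
  where
  adj : Adjacent (∣ a ∣ ℕ.* ∣ d ∣) (∣ b ∣ ℕ.* ∣ c ∣)
  adj = unimodular⇒adjacent a b c d det
  adj′ : Adjacent (∣ a ∣ ℕ.* ∣ d ∣) (∣ c ∣ ℕ.* ∣ b ∣)
  adj′ = subst (Adjacent _) (*-comm ∣ b ∣ ∣ c ∣) adj
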